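{- Let $s>0$ and let $z$ be a variable of type $A[\mathbf{B}^s]$, where $A$ is a $\Pi_1$-type. Then $\mathtt{sub}^s_A\,z^A_A\rightarrow^*_\beta z^A_A$.
   Context: Types of $\mathsf{IMLL}_2$: $A ::= \alpha\mid A\multimap A\mid\forall\alpha.A$. $\Pi_1 ::= \alpha\mid\Sigma_1\multimap\Pi_1\mid\forall\alpha.\Pi_1$ and $\Sigma_1 ::= \alpha\mid\Pi_1\multimap\Sigma_1$ (mutually defined). $\mathbf{B}=\forall\alpha.\alpha\multimap\alpha\multimap\alpha\otimes\alpha$ with $A\otimes B=\forall\alpha.(A\multimap B\multimap\alpha)\multimap\alpha$, and $\mathbf{B}^s$ is the $s$-fold tensor of $\mathbf{B}$; $A[\mathbf{B}^s]$ is $A$ with every free type variable replaced by $\mathbf{B}^s$. Linear $\lambda$-terms $\mathtt{sub}^s_A$ ($A$ a $\Pi_1$-type) and $\overline{\mathtt{sub}}^s_A$ ($A$ a $\Sigma_1$-type), by simultaneous induction: $\mathtt{sub}^s_\alpha=\overline{\mathtt{sub}}^s_\alpha=\lambda x.x$; $\mathtt{sub}^s_{\forall\alpha.B}=\mathtt{sub}^s_B$; $\mathtt{sub}^s_{B\multimap C}=\lambda x.\lambda y.\mathtt{sub}^s_C(x(\overline{\mathtt{sub}}^s_B\,y))$; $\overline{\mathtt{sub}}^s_{B\multimap C}=\lambda x.\lambda y.\overline{\mathtt{sub}}^s_C(x(\mathtt{sub}^s_B\,y))$. The $\eta$-long form: $\eta_\alpha(M)=M$, $\eta_{\forall\alpha.B}(M)=\eta_B(M)$,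 $\eta_{B\multimap C}(M)=\lambda y.\eta_C(M\,\eta_B(y))$ with $y$ fresh; $z^A_A:=\eta_A(z)$. -}

module Defs where

open import Data.Nat using (ℕ; zero; suc; _<_; _≤?_)
open import Data.Maybe using (Maybe; just; nothing)
open import Data.List using (List; []; _∷_)
open import Relation.Nullary using (yes; no)
open import Relation.Binary.Construct.Closure.ReflexiveTransitive using (Star)

-- Types of IMLL2, type variables as de Bruijn indices
-- (tvar n under k binders is free iff n ≥ k).

infixr 5 _⊸_
data Ty : Set where
  tvar : ℕ → Ty
  _⊸_  : Ty → Ty → Ty
  ∀'   : Ty → Ty

data Π₁ : Ty → Set
data Σ₁ : Ty → Set
data Π₁ where
  π-var : ∀ n → Π₁ (tvar n)
  π-⊸   : ∀ {B C} → Σ₁ B → Π₁ C → Π₁ (B ⊸ C)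
  π-∀   : ∀ {B} → Π₁ B → Π₁ (∀' B)
data Σ₁ where
  σ-var : ∀ n → Σ₁ (tvar n)
  σ-⊸   : ∀ {B C} → Π₁ B → Σ₁ C → Σ₁ (B ⊸ C)

tshift : ℕ → Ty → Ty
tshift c (tvar n) with c ≤? n
... | yes _ = tvar (suc n)
... | no  _ = tvar n
tshift c (A ⊸ B) = tshift c A ⊸ tshift c B
tshift c (∀' A)  = ∀' (tshift (suc c) A)

_⊗_ : Ty → Ty → Ty
A ⊗ B = ∀' ((tshift 0 A ⊸ tshift 0 B ⊸ tvar 0) ⊸ tvar 0)

𝐁 : Ty
𝐁 = ∀' (tvar 0 ⊸ tvar 0 ⊸ (tvar 0 ⊗ tvar 0))

-- s-fold tensor B^s (B^1 = B, B^(s+1) = B ⊗ B^s).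
-- The value at s = 0 is an unused junk value (the statement assumes s > 0).
𝐁^ : ℕ → Ty
𝐁^ zero          = 𝐁
𝐁^ (suc zero)    = 𝐁
𝐁^ (suc (suc s)) = 𝐁 ⊗ 𝐁^ (suc s)

-- A[C]: replace every free type variable of A by the closed type C
-- (k = number of type binders passed).
replFree : ℕ → Ty → Ty → Ty
replFree k (tvar n) C with k ≤? n
... | yes _ = C
... | no  _ = tvar n
replFree k (A ⊸ B) C = replFree k A C ⊸ replFree k B C
replFree k (∀' A)  C = ∀' (replFree (suc k) A C)

_[_] : Ty → Ty → Ty
A [ C ] = replFree 0 A C

infixl 7 _·_
data Tm : Set where
  var : ℕ → Tm
  ƛ   : Tm → Tm
  _·_ : Tm → Tm → Tm

rename : (ℕ → ℕ) → Tm → Tm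
rename ρ (var n) = var (ρ n)
rename ρ (ƛ M)   = ƛ (rename (λ { zero → zero ; (suc n) → suc (ρ n) }) M)
rename ρ (M · N) = rename ρ M · rename ρ N

weaken : Tm → Tm
weaken = rename suc

exts : (ℕ → Tm) → ℕ → Tm
exts σ zero    = var zero
exts σ (suc n) = weaken (σ n)

subst : (ℕ → Tm) → Tm → Tm
subst σ (var n) = σ n
subst σ (ƛ M)   = ƛ (subst (exts σ) M)
subst σ (M · N) = subst σ M · subst σ N

_[_/0] : Tm → Tm → Tm
M [ N /0] = subst (λ { zero → N ; (suc n) → var n }) M

infix 4 _→β_
data _→β_ : Tm → Tm → Set where
  β    : ∀ {M N} → (ƛ M) · N →β M [ N /0]
  ξ-ƛ  : ∀ {M M'} → M →β M' → ƛ M →β ƛ M'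
  ξ-·₁ : ∀ {M M' N} → M →β M' → M · N →β M' · N
  ξ-·₂ : ∀ {M N N'} → N →β N' → M · N →β M · N'

infix 4 _→β*_
_→β*_ : Tm → Tm → Set
_→β*_ = Star _→β_

-- These are closed terms, so no
-- shifting is needed when placing them under binders. The index s does not
-- influence the untyped term (it only fixes the intended typing).

sub  : ℕ → ∀ {A} → Π₁ A → Tm
sub‾ : ℕ → ∀ {A} → Σ₁ A → Tm
sub  s (π-var _)  = ƛ (var 0)
sub  s (π-∀ p)    = sub s p
sub  s (π-⊸ q p)  = ƛ (ƛ (sub s p · (var 1 · (sub‾ s q · var 0))))
sub‾ s (σ-var _)  = ƛ (var 0)
sub‾ s (σ-⊸ p q)  = ƛ (ƛ (sub‾ s q · (var 1 · (sub s p · var 0))))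

η : Ty → Tm → Tm
η (tvar _) M = M
η (∀' B)   M = η B M
η (B ⊸ C)  M = ƛ (η C (weaken M · η B (var 0)))

_!_ : List Ty → ℕ → Maybe Ty
[]      ! _     = nothing
(A ∷ Γ) ! zero  = just A
(A ∷ Γ) ! suc n = Γ ! n

-- For A = B ⊸ C, two
-- β-steps turn sub_A (η_A M) into λy. sub_C (η_C (M (η_B (sub‾_B y))));
-- the induction hypotheses then remove sub_C and sub‾_B, the latter inside
-- the context λy. η_C (M (η_B □)).
module Submission where

open import Defs
open import Data.Nat using (ℕ; _<_; zero; suc)
open import Data.List using (List)
open import Data.Maybe using (just)
open import Function using (_∘_)
open import Relation.Binary.PropositionalEquality using (_≡_; refl; sym; trans; cong; cong₂)
open import Relation.Binary.Construct.Closure.ReflexiveTransitive using (ε; _◅_; _◅◅_; gmap)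

rename-cong : ∀ {ρ ρ'} → (∀ n → ρ n ≡ ρ' n) → ∀ M → rename ρ M ≡ rename ρ' M
rename-cong h (var n) = cong var (h n)
rename-cong h (ƛ M)   = cong ƛ (rename-cong (λ { zero → refl ; (suc n) → cong suc (h n) }) M)
rename-cong h (M · N) = cong₂ _·_ (rename-cong h M) (rename-cong h N)

subst-cong : ∀ {σ τ} → (∀ n → σ n ≡ τ n) → ∀ M → subst σ M ≡ subst τ M
subst-cong h (var n) = h n
subst-cong h (ƛ M)   = cong ƛ (subst-cong (λ { zero → refl ; (suc n) → cong weaken (h n) }) M)
subst-cong h (M · N) = cong₂ _·_ (subst-cong h M) (subst-cong h N)

rename-rename : ∀ ρ ρ' M → rename ρ (rename ρ' M) ≡ rename (ρ ∘ ρ') M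
rename-rename ρ ρ' (var n) = refl
rename-rename ρ ρ' (ƛ M)   =
  cong ƛ (trans (rename-rename _ _ M) (rename-cong (λ { zero → refl ; (suc n) → refl }) M))
rename-rename ρ ρ' (M · N) = cong₂ _·_ (rename-rename ρ ρ' M) (rename-rename ρ ρ' N)

subst-rename : ∀ σ ρ M → subst σ (rename ρ M) ≡ subst (σ ∘ ρ) M
subst-rename σ ρ (var n) = refl
subst-rename σ ρ (ƛ M)   =
  cong ƛ (trans (subst-rename _ _ M) (subst-cong (λ { zero → refl ; (suc n) → refl }) M))
subst-rename σ ρ (M · N) = cong₂ _·_ (subst-rename σ ρ M) (subst-rename σ ρ N)

rename-subst : ∀ ρ σ M → rename ρ (subst σ M) ≡ subst (rename ρ ∘ σ) M
rename-subst ρ σ (var n) = refl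
rename-subst ρ σ (ƛ M)   = cong ƛ (trans (rename-subst _ _ M) (subst-cong exts-comm M))
  where
  exts-comm : ∀ n → rename _ (exts σ n) ≡ exts (rename ρ ∘ σ) n
  exts-comm zero    = refl
  exts-comm (suc n) = trans (rename-rename _ suc (σ n)) (sym (rename-rename suc ρ (σ n)))
rename-subst ρ σ (M · N) = cong₂ _·_ (rename-subst ρ σ M) (rename-subst ρ σ N)

rename-as-subst : ∀ ρ M → rename ρ M ≡ subst (var ∘ ρ) M
rename-as-subst ρ (var n) = refl
rename-as-subst ρ (ƛ M)   =
  cong ƛ (trans (rename-as-subst _ M) (subst-cong (λ { zero → refl ; (suc n) → refl }) M))
rename-as-subst ρ (M · N) = cong₂ _·_ (rename-as-subst ρ M) (rename-as-subst ρ N)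

subst-id : ∀ {σ} → (∀ n → σ n ≡ var n) → ∀ M → subst σ M ≡ M
subst-id h (var n) = h n
subst-id h (ƛ M)   = cong ƛ (subst-id (λ { zero → refl ; (suc n) → cong weaken (h n) }) M)
subst-id h (M · N) = cong₂ _·_ (subst-id h M) (subst-id h N)

weaken-[/0] : ∀ M N → weaken M [ N /0] ≡ M
weaken-[/0] M N = trans (subst-rename _ suc M) (subst-id (λ n → refl) M)

Closed : Tm → Set
Closed M = ∀ σ → subst σ M ≡ M

closed-rename : ∀ {M} → Closed M → ∀ ρ → rename ρ M ≡ M
closed-rename {M} c ρ = trans (rename-as-subst ρ M) (c (var ∘ ρ))

β-≡ : ∀ {M N R} → M [ N /0] ≡ R → ƛ M · N →β R
β-≡ refl = β

≡⇒→β* : ∀ {M N} → M ≡ N → M →β* N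
≡⇒→β* refl = ε

rename-→β : ∀ ρ {M M'} → M →β M' → rename ρ M →β rename ρ M'
rename-→β ρ (β {M} {N}) = β-≡ (trans (subst-rename _ _ M)
  (trans (subst-cong (λ { zero → refl ; (suc n) → refl }) M) (sym (rename-subst ρ _ M))))
rename-→β ρ (ξ-ƛ r)     = ξ-ƛ (rename-→β _ r)
rename-→β ρ (ξ-·₁ r)    = ξ-·₁ (rename-→β ρ r)
rename-→β ρ (ξ-·₂ r)    = ξ-·₂ (rename-→β ρ r)

-- sub and sub‾ at an arrow type are definitionally of this shape.
conjugate : Tm → Tm → Tm
conjugate F G = ƛ (ƛ (F · (var 1 · (G · var 0))))

conjugate-closed : ∀ {F G} → Closed F → Closed G → Closed (conjugate F G)
conjugate-closed cF cG σ =
  cong ƛ (cong ƛ (cong₂ _·_ (cF _) (cong (var 1 ·_) (cong (_· var 0) (cG _)))))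

conjugate-→β : ∀ {F G} → Closed F → Closed G → ∀ M →
  conjugate F G · M →β ƛ (F · (weaken M · (G · var 0)))
conjugate-→β cF cG M = β-≡ (cong ƛ (cong₂ _·_ (cF _) (cong (weaken M ·_) (cong (_· var 0) (cG _)))))

conjugate-→β* : ∀ {F G} → Closed F → Closed G → ∀ M N →
  conjugate F G · M · N →β* F · (M · (G · N))
conjugate-→β* cF cG M N =
  ξ-·₁ (conjugate-→β cF cG M)
  ◅ β-≡ (cong₂ _·_ (cF _) (cong₂ _·_ (weaken-[/0] M N) (cong (_· N) (cG _))))
  ◅ ε

η-subst : ∀ A σ M → subst σ (η A M) ≡ η A (subst σ M)
η-subst (tvar _) σ M = refl
η-subst (∀' A)   σ M = η-subst A σ M
η-subst (B ⊸ C)  σ M = cong ƛ (trans (η-subst C (exts σ) _)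
  (cong (η C) (cong₂ _·_ (subst-weaken M) (η-subst B (exts σ) (var 0)))))
  where
  subst-weaken : ∀ M → subst (exts σ) (weaken M) ≡ weaken (subst σ M)
  subst-weaken M = trans (subst-rename (exts σ) suc M) (sym (rename-subst suc σ M))

η-rename : ∀ A ρ M → rename ρ (η A M) ≡ η A (rename ρ M)
η-rename A ρ M = trans (rename-as-subst ρ (η A M))
  (trans (η-subst A _ M) (cong (η A) (sym (rename-as-subst ρ M))))

η-⊸-β : ∀ B C M N → η (B ⊸ C) M · N →β η C (M · η B N)
η-⊸-β B C M N = β-≡ (trans (η-subst C _ _)
  (cong (η C) (cong₂ _·_ (weaken-[/0] M N) (η-subst B _ (var 0)))))

η-→β : ∀ A {M M'} → M →β M' → η A M →β η A M'
η-→β (tvar _) r = r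
η-→β (∀' A)   r = η-→β A r
η-→β (B ⊸ C)  r = ξ-ƛ (η-→β C (ξ-·₁ (rename-→β suc r)))

module _ (s : ℕ) where

  sub-closed  : ∀ {A} (p : Π₁ A) → Closed (sub s p)
  sub‾-closed : ∀ {A} (q : Σ₁ A) → Closed (sub‾ s q)
  sub-closed (π-var _) σ = refl
  sub-closed (π-∀ p)   σ = sub-closed p σ
  sub-closed (π-⊸ q p)   = conjugate-closed (sub-closed p) (sub‾-closed q)
  sub‾-closed (σ-var _) σ = refl
  sub‾-closed (σ-⊸ p q)   = conjugate-closed (sub‾-closed q) (sub-closed p)

  sub-η-→β*  : ∀ {A} (p : Π₁ A) M → sub s p · η A M →β* η A M
  η-sub‾-→β* : ∀ {B} (q : Σ₁ B) N → η B (sub‾ s q · N) →β* η B N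

  sub-η-→β* (π-var _) M = β ◅ ε
  sub-η-→β* (π-∀ p)   M = sub-η-→β* p M
  sub-η-→β* (π-⊸ {B} {C} q p) M =
    conjugate-→β (sub-closed p) (sub‾-closed q) (η (B ⊸ C) M)
    ◅ ξ-ƛ (ξ-·₂ unfold-η)
    ◅ gmap ƛ ξ-ƛ (sub-η-→β* p _)
    ◅◅ gmap (λ t → ƛ (η C (weaken M · t))) (ξ-ƛ ∘ η-→β C ∘ ξ-·₂) (η-sub‾-→β* q (var 0))
    where
    unfold-η : weaken (η (B ⊸ C) M) · (sub‾ s q · var 0)
               →β η C (weaken M · η B (sub‾ s q · var 0))
    unfold-η rewrite η-rename (B ⊸ C) suc M = η-⊸-β B C (weaken M) _

  η-sub‾-→β* (σ-var _) N = β ◅ ε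
  η-sub‾-→β* (σ-⊸ {D} {E} p q) N =
    gmap (λ t → ƛ (η E t)) (ξ-ƛ ∘ η-→β E)
      (≡⇒→β* (cong (_· η D (var 0)) (cong (_· weaken N) (closed-rename (sub‾-closed (σ-⊸ p q)) suc)))
       ◅◅ conjugate-→β* (sub‾-closed q) (sub-closed p) (weaken N) (η D (var 0)))
    ◅◅ gmap ƛ ξ-ƛ (η-sub‾-→β* q _)
    ◅◅ gmap (λ t → ƛ (η E (weaken N · t))) (ξ-ƛ ∘ η-→β E ∘ ξ-·₂) (sub-η-→β* p (var 0))

lemmaA7 : (s : ℕ) → 0 < s → (A : Ty) (p : Π₁ A) (Γ : List Ty) (z : ℕ)
    → Γ ! z ≡ just (A [ 𝐁^ s ])
    → sub s p · η A (var z) →β* η A (var z)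
lemmaA7 s _ A p Γ z _ = sub-η-→β* s p (var z)
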